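{- Let $n\in\mathbb{N}$ with $n\ge2$. Then \[ \int_{\mathbb{Z}_p} x^2x^{[n-2]}\,d\mu_1(x)=\sum_{k=0}^{n}t(n,k)B_k+\left(\frac{n-2}{2}\right)^2\sum_{k=0}^{n-2}t(n-2,k)B_k . \]
   Context: $p$ is an odd prime. For a polynomial $f:\mathbb{Z}_p\to\mathbb{C}_p$ the Volkenborn integral is $\int_{\mathbb{Z}_p} f(x)\,d\mu_1(x)=\lim_{N\to\infty}p^{ -N}\sum_{x=0}^{p^N-1}f(x)$. The central factorial is $x^{[0]}=1$ and, for $n\in\mathbb{N}$, $x^{[n]}=x\prod_{j=1}^{n-1}\left(x+\frac n2-j\right)$. The central factorial numbers of the first kind $t(n,k)$ are defined by $x^{[n]}=\sum_{k=0}^n t(n,k)x^k$. The Bernoulli numbers $B_k$ are defined by $\frac{t}{e^t-1}=\sum_{k\ge0}B_k\frac{t^k}{k!}$. -}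

module Defs where

open import Data.Nat as ℕ using (ℕ; zero; suc; _∸_; _^_; _!)
open import Data.Nat.Properties using (_!≢0; m^n≢0)
open import Data.Bool using (true; false)
import Data.Product
open import Data.Integer as ℤ using (ℤ; +_)
import Data.Integer.Divisibility as ℤDiv
open import Data.Nat.Divisibility using (_∣_)
open import Data.Rational as ℚ using (ℚ; _+_; _*_; _-_; -_; _/_; 0ℚ; 1ℚ; ↥_; ↧ₙ_)
open import Data.List using (List; []; _∷_)
open import Data.Product using (∃)
open import Relation.Nullary using (¬_)

ι : ℕ → ℚ
ι n = + n / 1

sumTo : ℕ → (ℕ → ℚ) → ℚ
sumTo zero    f = 0ℚ
sumTo (suc n) f = sumTo n f + f n

prodFrom1 : ℕ → (ℕ → ℚ) → ℚ
prodFrom1 zero    f = 1ℚ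
prodFrom1 (suc m) f = prodFrom1 m f * f (suc m)

half : ℕ → ℚ
half n = + n / 2

centralFactorial : ℕ → ℚ → ℚ
centralFactorial zero    x = 1ℚ
centralFactorial (suc m) x = x * prodFrom1 m (λ j → x + half (suc m) - ι j)

-- Polynomials over ℚ as coefficient lists (constant term first)

Poly : Set
Poly = List ℚ

scalePoly : ℚ → Poly → Poly
scalePoly c []       = []
scalePoly c (a ∷ as) = c * a ∷ scalePoly c as

addPoly : Poly → Poly → Poly
addPoly []       q        = q
addPoly (a ∷ as) []       = a ∷ as
addPoly (a ∷ as) (b ∷ bs) = (a + b) ∷ addPoly as bs

mulLinear : ℚ → Poly → Poly
mulLinear c q = addPoly (0ℚ ∷ q) (scalePoly c q)

coeff : Poly → ℕ → ℚ
coeff []       k       = 0ℚ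
coeff (a ∷ as) zero    = a
coeff (a ∷ as) (suc k) = coeff as k

prodLinear : ℕ → (ℕ → ℚ) → Poly
prodLinear zero    c = 0ℚ ∷ 1ℚ ∷ []
prodLinear (suc m) c = mulLinear (c (suc m)) (prodLinear m c)

centralPoly : ℕ → Poly
centralPoly zero    = 1ℚ ∷ []
centralPoly (suc m) = prodLinear m (λ j → half (suc m) - ι j)

t : ℕ → ℕ → ℚ
t n k = coeff (centralPoly n) k

-- Bernoulli numbers, t/(e^t-1) = Σ B_k t^k/k!.
-- Coefficientwise, ((e^t-1)/t)·(Σ B_j t^j/j!) = 1 reads
--   Σ_{j=0}^{m} B_j /(j! (m+1-j)!) = δ_{m,0},
-- i.e. B_0 = 1 and B_m = - m! Σ_{j<m} B_j /(j! (m+1-j)!) for m ≥ 1.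

invFact : ℕ → ℚ
invFact n = (+ 1 / (n !)) {{n !≢0}}

bernoulliList : ℕ → (ℕ → ℚ)  -- bernoulliList m j = B_j for j ≤ m
bernoulliList zero    j = 1ℚ
bernoulliList (suc m) j with j ℕ.≤ᵇ m
... | true  = bernoulliList m j
... | false =
  - (ι (suc m !) * sumTo (suc m) (λ i → bernoulliList m i * invFact i * invFact (suc (suc m) ∸ i)))

B : ℕ → ℚ
B k = bernoulliList k k

padicValGE : ℕ → ℕ → ℚ → Set
padicValGE p m q = ((p ^ m) ∣ ℤ.∣ ↥ q ∣) Data.Product.× (¬ (p ∣ (↧ₙ q)))

-- a N → L in ℚ_p (equivalently in ℂ_p): |a N - L|_p → 0
PadicLimit : ℕ → (ℕ → ℚ) → ℚ → Set
PadicLimit p a L = ∀ (m : ℕ) → ∃ λ N₀ → ∀ N → N₀ ℕ.≤ N → padicValGE p m (a N - L)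

invPow : ℕ → ℕ → ℚ
invPow zero    N = 0ℚ
invPow (suc k) N = (+ 1 / (suc k ^ N)) {{m^n≢0 (suc k) N}}

volkenbornSum : ℕ → (ℚ → ℚ) → ℕ → ℚ
volkenbornSum p f N = invPow p N * sumTo (p ^ N) (λ x → f (ι x))

VolkenbornIntegral : ℕ → (ℚ → ℚ) → ℚ → Set
VolkenbornIntegral p f L = PadicLimit p (volkenbornSum p f) L

-- By the binomial theorem and telescoping, the power sums S_j(y) = Σ_{x<y} x^j satisfy
-- Σ_{j≤M} C(M+1,j) S_j(y) = y^(M+1), while the Bernoulli numbers satisfy
-- Σ_{j≤M} C(M+1,j) B_j = δ_{M,0}.  So the errors E_j(N) = p^(-N) S_j(p^N) - B_j obey
-- Σ_{j≤M} C(M+1,j) E_j(N) = p^(NM) - δ_{M,0}, whose right side tends to 0 p-adically; solving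
-- for E_M (multiplying by the fixed rational 1/(M+1) only shifts valuations by a constant)
-- gives E_j(N) → 0 by strong induction on j, i.e. ∫ x^j dμ₁ = B_j.  The integral is linear,
-- so ∫ x^[n] dμ₁ = Σ_k t(n,k) B_k, and x^[m+2] = (x + m/2)(x - m/2) x^[m] rewrites the
-- integrand x² x^[m] as x^[m+2] + (m/2)² x^[m].

module Submission where

open import Defs
open import Data.Nat using (ℕ; suc; _≤_; _∸_)
open import Data.Nat.Primality using (Prime)
open import Data.Integer using (+_)
open import Data.Rational using (ℚ; _+_; _*_; _/_)
open import Relation.Binary.PropositionalEquality using (_≢_)

import Data.Nat as ℕ
import Data.Nat.Properties as ℕ
open import Data.Nat using (zero; _<_; _!; s≤s)
open import Data.Nat.Properties using (_!≢0; _!*_!≢0)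
open import Data.Nat.Combinatorics using (_C_; nCn≡1; nC1≡n; nCk≡nC[n∸k]; nCk≡n!/k![n-k]!; k![n∸k]!∣n!)
open import Data.Nat.Divisibility using (_∣_; _∣?_; divides; ∣-trans; m∣m*n; n∣m*n; ∣1⇒≡1; 1∣_; *-monoʳ-∣; *-cancelˡ-∣; quotient≢0; quotient-<)
open import Data.Nat.DivMod using (m/n*n≡m)
open import Data.Nat.Primality using (prime⇒nonTrivial; euclidsLemma)
open import Data.Nat.Coprimality using (Coprime; recompute)
open import Data.Nat.Induction using (<-rec)
open import Data.Integer as ℤ using (ℤ)
import Data.Integer.Properties as ℤ
import Data.Integer.Tactic.RingSolver as ℤ-Solver
open import Data.Rational using (_-_; -_; 0ℚ; 1ℚ; ↥_; ↧ₙ_; mkℚ; fromℚᵘ)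
import Data.Rational.Properties as ℚ
import Data.Rational.Unnormalised as ℚᵘ
import Data.Rational.Unnormalised.Properties as ℚᵘ
open import Data.Fin using (Fin; toℕ; fromℕ; inject₁)
open import Data.Fin.Properties using (toℕ-fromℕ; toℕ-inject₁)
open import Data.List using ([]; _∷_; length)
open import Data.Bool using (true; false; T)
open import Data.Unit using (tt)
open import Data.Empty using (⊥-elim)
open import Data.Sum using (inj₁; inj₂; [_,_]′)
open import Data.Product using (∃; ∃₂; _×_; _,_)
open import Relation.Nullary using (¬_; yes; no)
open import Relation.Nullary.Decidable using (dec⇒maybe)
open import Relation.Binary.PropositionalEquality using (_≡_; refl; sym; trans; cong; cong₂; subst; module ≡-Reasoning)
open import Algebra.Bundles using (CommutativeRing; CommutativeSemiring)
open import Tactic.RingSolver using (solve-∀)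
open import Tactic.RingSolver.Core.AlmostCommutativeRing using (AlmostCommutativeRing; fromCommutativeRing)

-- A genuine zero test lets the reflective solver cancel rational constants.
ℚ-ring : AlmostCommutativeRing _ _
ℚ-ring = fromCommutativeRing ℚ.+-*-commutativeRing (λ x → dec⇒maybe (0ℚ ℚ.≟ x))

ℚ-commutativeSemiring : CommutativeSemiring _ _
ℚ-commutativeSemiring = CommutativeRing.commutativeSemiring ℚ.+-*-commutativeRing

open CommutativeSemiring ℚ-commutativeSemiring using (semiring)
open import Algebra.Properties.Semiring.Exp semiring using (_^_)
import Algebra.Properties.Semiring.Mult semiring as Mult
open import Algebra.Properties.Semiring.Sum semiring using (sum; sum-init-last; sum-cong-≗)
import Algebra.Properties.CommutativeSemiring.Binomial ℚ-commutativeSemiring as Binomial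

fromℚᵘ-homo-+ : ∀ u v → fromℚᵘ (u ℚᵘ.+ v) ≡ fromℚᵘ u + fromℚᵘ v
fromℚᵘ-homo-+ u v = ℚ.toℚᵘ-injective (ℚᵘ.≃-trans (ℚ.toℚᵘ-fromℚᵘ (u ℚᵘ.+ v)) (ℚᵘ.≃-sym
  (ℚᵘ.≃-trans (ℚ.toℚᵘ-homo-+ (fromℚᵘ u) (fromℚᵘ v)) (ℚᵘ.+-cong (ℚ.toℚᵘ-fromℚᵘ u) (ℚ.toℚᵘ-fromℚᵘ v)))))

fromℚᵘ-homo-* : ∀ u v → fromℚᵘ (u ℚᵘ.* v) ≡ fromℚᵘ u * fromℚᵘ v
fromℚᵘ-homo-* u v = ℚ.toℚᵘ-injective (ℚᵘ.≃-trans (ℚ.toℚᵘ-fromℚᵘ (u ℚᵘ.* v)) (ℚᵘ.≃-sym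
  (ℚᵘ.≃-trans (ℚ.toℚᵘ-homo-* (fromℚᵘ u) (fromℚᵘ v)) (ℚᵘ.*-cong (ℚ.toℚᵘ-fromℚᵘ u) (ℚ.toℚᵘ-fromℚᵘ v)))))

-- i / suc d is definitionally fromℚᵘ (mkℚᵘ i d).
/1-homo-+ : ∀ i j → (i ℤ.+ j) / 1 ≡ i / 1 + j / 1
/1-homo-+ i j = trans (ℚ.fromℚᵘ-cong {ℚᵘ.mkℚᵘ (i ℤ.+ j) 0} {ℚᵘ.mkℚᵘ i 0 ℚᵘ.+ ℚᵘ.mkℚᵘ j 0} (ℚᵘ.*≡* (ring i j)))
  (fromℚᵘ-homo-+ (ℚᵘ.mkℚᵘ i 0) (ℚᵘ.mkℚᵘ j 0))
  where
  ring : ∀ i j → (i ℤ.+ j) ℤ.* + 1 ≡ (i ℤ.* + 1 ℤ.+ j ℤ.* + 1) ℤ.* + 1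
  ring = ℤ-Solver.solve-∀

/1-homo-* : ∀ i j → (i ℤ.* j) / 1 ≡ (i / 1) * (j / 1)
/1-homo-* i j = fromℚᵘ-homo-* (ℚᵘ.mkℚᵘ i 0) (ℚᵘ.mkℚᵘ j 0)

ι-+ : ∀ m n → ι (m ℕ.+ n) ≡ ι m + ι n
ι-+ m n = trans (cong (_/ 1) (ℤ.pos-+ m n)) (/1-homo-+ (+ m) (+ n))

ι-* : ∀ m n → ι (m ℕ.* n) ≡ ι m * ι n
ι-* m n = trans (cong (_/ 1) (ℤ.pos-* m n)) (/1-homo-* (+ m) (+ n))

ι-suc : ∀ n → ι (suc n) ≡ ι n + 1ℚ
ι-suc n = trans (cong ι (ℕ.+-comm 1 n)) (ι-+ n 1)

ι-^ : ∀ a M → ι a ^ M ≡ ι (a ℕ.^ M)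
ι-^ a zero    = refl
ι-^ a (suc M) = trans (cong (ι a *_) (ι-^ a M)) (sym (ι-* a (a ℕ.^ M)))

/-*-cancelʳ : ∀ i d .{{_ : ℕ.NonZero d}} → (i / d) * ι d ≡ i / 1
/-*-cancelʳ i (suc d) = trans (sym (fromℚᵘ-homo-* (ℚᵘ.mkℚᵘ i d) (ℚᵘ.mkℚᵘ (+ suc d) 0)))
  (ℚ.fromℚᵘ-cong {ℚᵘ.mkℚᵘ i d ℚᵘ.* ℚᵘ.mkℚᵘ (+ suc d) 0} {ℚᵘ.mkℚᵘ i 0} (ℚᵘ.*≡* (ring i (+ suc d))))
  where
  ring : ∀ i d → i ℤ.* d ℤ.* + 1 ≡ i ℤ.* (d ℤ.* + 1)
  ring = ℤ-Solver.solve-∀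

/1-injective : ∀ i j → i / 1 ≡ j / 1 → i ≡ j
/1-injective i j eq with ℚ.fromℚᵘ-injective {ℚᵘ.mkℚᵘ i 0} {ℚᵘ.mkℚᵘ j 0} eq
... | ℚᵘ.*≡* i*1≡j*1 = trans (sym (ℤ.*-identityʳ i)) (trans i*1≡j*1 (ℤ.*-identityʳ j))

q*ι[↧q]≡↥q : ∀ q → q * ι (↧ₙ q) ≡ ↥ q / 1
q*ι[↧q]≡↥q q = trans (cong (_* ι (↧ₙ q)) (sym (ℚ.↥p/↧p≡p q))) (/-*-cancelʳ (↥ q) (↧ₙ q))

↥↧-coprime : ∀ q → Coprime ℤ.∣ ↥ q ∣ (↧ₙ q)
↥↧-coprime (mkℚ n d-1 coprime) = recompute coprime

-- Finite sums and the binomial theorem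

sumTo-cong : ∀ n {f g : ℕ → ℚ} → (∀ i → i < n → f i ≡ g i) → sumTo n f ≡ sumTo n g
sumTo-cong zero    f≗g = refl
sumTo-cong (suc n) f≗g = cong₂ _+_ (sumTo-cong n (λ i i<n → f≗g i (ℕ.m<n⇒m<1+n i<n))) (f≗g n ℕ.≤-refl)

sumTo-0 : ∀ n → sumTo n (λ _ → 0ℚ) ≡ 0ℚ
sumTo-0 zero    = refl
sumTo-0 (suc n) = trans (ℚ.+-identityʳ _) (sumTo-0 n)

sumTo-+ : ∀ n (f g : ℕ → ℚ) → sumTo n (λ i → f i + g i) ≡ sumTo n f + sumTo n g
sumTo-+ zero    f g = refl
sumTo-+ (suc n) f g = trans (cong (_+ (f n + g n)) (sumTo-+ n f g)) (ring (sumTo n f) (sumTo n g) (f n) (g n))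
  where
  ring : ∀ a b c d → (a + b) + (c + d) ≡ (a + c) + (b + d)
  ring = solve-∀ ℚ-ring

*-distribˡ-sumTo : ∀ n c (f : ℕ → ℚ) → c * sumTo n f ≡ sumTo n (λ i → c * f i)
*-distribˡ-sumTo zero    c f = ℚ.*-zeroʳ c
*-distribˡ-sumTo (suc n) c f = trans (ℚ.*-distribˡ-+ c (sumTo n f) (f n)) (cong (_+ c * f n) (*-distribˡ-sumTo n c f))

sumTo-- : ∀ n (f g : ℕ → ℚ) → sumTo n (λ i → f i - g i) ≡ sumTo n f - sumTo n g
sumTo-- zero    f g = sym (ℚ.+-inverseʳ 0ℚ)
sumTo-- (suc n) f g = trans (cong (_+ (f n - g n)) (sumTo-- n f g)) (ring (sumTo n f) (sumTo n g) (f n) (g n))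
  where
  ring : ∀ a b c d → (a - b) + (c - d) ≡ (a + c) - (b + d)
  ring = solve-∀ ℚ-ring

sumTo-comm : ∀ m n (f : ℕ → ℕ → ℚ) → sumTo m (λ i → sumTo n (f i)) ≡ sumTo n (λ j → sumTo m (λ i → f i j))
sumTo-comm zero    n f = sym (sumTo-0 n)
sumTo-comm (suc m) n f = trans (cong (_+ sumTo n (f m)) (sumTo-comm m n f)) (sym (sumTo-+ n _ (f m)))

sumTo-shift : ∀ n (f : ℕ → ℚ) → sumTo (suc n) f ≡ f 0 + sumTo n (λ i → f (suc i))
sumTo-shift zero    f = ℚ.+-comm 0ℚ (f 0)
sumTo-shift (suc n) f = trans (cong (_+ f (suc n)) (sumTo-shift n f)) (ℚ.+-assoc (f 0) _ _)

sumTo-telescope : ∀ n (f : ℕ → ℚ) → sumTo n (λ i → f (suc i) - f i) ≡ f n - f 0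
sumTo-telescope zero    f = sym (ℚ.+-inverseʳ (f 0))
sumTo-telescope (suc n) f = trans (cong (_+ (f (suc n) - f n)) (sumTo-telescope n f)) (ring (f n) (f (suc n)) (f 0))
  where
  ring : ∀ a b c → (a - c) + (b - a) ≡ b - c
  ring = solve-∀ ℚ-ring

×-ι : ∀ n x → n Mult.× x ≡ ι n * x
×-ι zero    x = sym (ℚ.*-zeroˡ x)
×-ι (suc n) x = trans (cong (λ w → x + w) (×-ι n x)) (trans (ring x (ι n)) (cong (_* x) (sym (ι-suc n))))
  where
  ring : ∀ x a → x + a * x ≡ (a + 1ℚ) * x
  ring = solve-∀ ℚ-ring

1^n≡1 : ∀ n → 1ℚ ^ n ≡ 1ℚ
1^n≡1 zero    = refl
1^n≡1 (suc n) = trans (ℚ.*-identityˡ _) (1^n≡1 n)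

sumTo-sum : ∀ n (f : ℕ → ℚ) → sumTo n f ≡ sum (λ (i : Fin n) → f (toℕ i))
sumTo-sum zero    f = refl
sumTo-sum (suc n) f = sym (begin
  sum (λ (i : Fin (suc n)) → f (toℕ i))
    ≡⟨ sum-init-last {n} (λ i → f (toℕ i)) ⟩
  sum (λ (i : Fin n) → f (toℕ (inject₁ i))) + f (toℕ (fromℕ n))
    ≡⟨ cong₂ _+_ (sum-cong-≗ {n} (λ i → cong f (toℕ-inject₁ i))) (cong f (toℕ-fromℕ n)) ⟩
  sum (λ (i : Fin n) → f (toℕ i)) + f n
    ≡⟨ cong (_+ f n) (sumTo-sum n f) ⟨
  sumTo (suc n) f
    ∎)
  where open ≡-Reasoning

binomial : ∀ n z → (z + 1ℚ) ^ n ≡ sumTo (suc n) (λ k → ι (n C k) * z ^ k)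
binomial n z = begin
  (z + 1ℚ) ^ n                                                ≡⟨ Binomial.theorem n z 1ℚ ⟩
  Binomial.binomialExpansion z 1ℚ n                           ≡⟨ sumTo-sum (suc n) term ⟨
  sumTo (suc n) term                                          ≡⟨ sumTo-cong (suc n) (λ k _ → term≡ k) ⟩
  sumTo (suc n) (λ k → ι (n C k) * z ^ k)                     ∎
  where
  open ≡-Reasoning
  term : ℕ → ℚ
  term k = (n C k) Mult.× (z ^ k * 1ℚ ^ (n ∸ k))
  term≡ : ∀ k → term k ≡ ι (n C k) * z ^ k
  term≡ k = begin
    (n C k) Mult.× (z ^ k * 1ℚ ^ (n ∸ k))  ≡⟨ ×-ι (n C k) _ ⟩
    ι (n C k) * (z ^ k * 1ℚ ^ (n ∸ k))     ≡⟨ cong (λ w → ι (n C k) * (z ^ k * w)) (1^n≡1 (n ∸ k)) ⟩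
    ι (n C k) * (z ^ k * 1ℚ)              ≡⟨ cong (ι (n C k) *_) (ℚ.*-identityʳ (z ^ k)) ⟩
    ι (n C k) * z ^ k                     ∎

sumTo-C-^ : ∀ M z → sumTo (suc M) (λ j → ι (suc M C j) * z ^ j) ≡ (z + 1ℚ) ^ suc M - z ^ suc M
sumTo-C-^ M z = begin
  S                                             ≡⟨ ring S (z ^ suc M) ⟩
  S + 1ℚ * z ^ suc M - z ^ suc M                ≡⟨ cong (λ c → S + ι c * z ^ suc M - z ^ suc M) (nCn≡1 (suc M)) ⟨
  S + ι (suc M C suc M) * z ^ suc M - z ^ suc M ≡⟨ cong (_- z ^ suc M) (binomial (suc M) z) ⟨
  (z + 1ℚ) ^ suc M - z ^ suc M                  ∎
  where
  open ≡-Reasoning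
  S = sumTo (suc M) (λ j → ι (suc M C j) * z ^ j)
  ring : ∀ s w → s ≡ s + 1ℚ * w - w
  ring = solve-∀ ℚ-ring

sumTo-C-powerSum : ∀ M y → sumTo (suc M) (λ j → ι (suc M C j) * sumTo y (λ x → ι x ^ j)) ≡ ι y ^ suc M
sumTo-C-powerSum M y = begin
  sumTo (suc M) (λ j → ι (suc M C j) * sumTo y (λ x → ι x ^ j))
    ≡⟨ sumTo-cong (suc M) (λ j _ → *-distribˡ-sumTo y (ι (suc M C j)) (λ x → ι x ^ j)) ⟩
  sumTo (suc M) (λ j → sumTo y (λ x → ι (suc M C j) * ι x ^ j))
    ≡⟨ sumTo-comm (suc M) y (λ j x → ι (suc M C j) * ι x ^ j) ⟩
  sumTo y (λ x → sumTo (suc M) (λ j → ι (suc M C j) * ι x ^ j))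
    ≡⟨ sumTo-cong y (λ x _ → trans (sumTo-C-^ M (ι x)) (cong (λ w → w ^ suc M - ι x ^ suc M) (sym (ι-suc x)))) ⟩
  sumTo y (λ x → ι (suc x) ^ suc M - ι x ^ suc M)
    ≡⟨ sumTo-telescope y (λ x → ι x ^ suc M) ⟩
  ι y ^ suc M - 0ℚ * 0ℚ ^ M
    ≡⟨ cong (λ w → ι y ^ suc M - w) (ℚ.*-zeroˡ (0ℚ ^ M)) ⟩
  ι y ^ suc M - 0ℚ
    ≡⟨ ℚ.+-identityʳ _ ⟩
  ι y ^ suc M
    ∎
  where open ≡-Reasoning

-- Bernoulli numbers

δ₀ : ℕ → ℚ
δ₀ zero    = 1ℚ
δ₀ (suc _) = 0ℚ

bernoulliList-suc : ∀ m j → j ≤ m → bernoulliList (suc m) j ≡ bernoulliList m j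
bernoulliList-suc m j j≤m with j ℕ.≤ᵇ m in eq
... | true  = refl
... | false = ⊥-elim (subst T eq (ℕ.≤⇒≤ᵇ j≤m))

bernoulliList-stable : ∀ m j → j ≤ m → bernoulliList m j ≡ B j
bernoulliList-stable zero    zero j≤m = refl
bernoulliList-stable (suc m) j j≤m with ℕ.m≤n⇒m<n∨m≡n j≤m
... | inj₂ refl        = refl
... | inj₁ (s≤s j≤m′) = trans (bernoulliList-suc m j j≤m′) (bernoulliList-stable m j j≤m′)

B-suc : ∀ m → B (suc m) ≡ - (ι (suc m !) * sumTo (suc m) (λ i → B i * invFact i * invFact (suc (suc m) ∸ i)))
B-suc m with suc m ℕ.≤ᵇ m in eq
... | true  = ⊥-elim (ℕ.n≮n m (ℕ.≤ᵇ⇒≤ (suc m) m (subst T (sym eq) tt)))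
... | false = cong (λ s → - (ι (suc m !) * s))
  (sumTo-cong (suc m) (λ i i<suc-m → cong (λ b → b * invFact i * invFact (suc (suc m) ∸ i)) (bernoulliList-stable m i (ℕ.≤-pred i<suc-m))))

ι[n!]*invFact[n]≡1 : ∀ n → ι (n !) * invFact n ≡ 1ℚ
ι[n!]*invFact[n]≡1 n = trans (ℚ.*-comm (ι (n !)) (invFact n)) (/-*-cancelʳ (+ 1) (n !) {{n !≢0}})

ι-C : ∀ n j → j ≤ n → ι (n C j) ≡ ι (n !) * invFact j * invFact (n ∸ j)
ι-C n j j≤n = sym (begin
  ι (n !) * invFact j * invFact (n ∸ j)
    ≡⟨ cong (λ w → w * invFact j * invFact (n ∸ j)) ι[n!]≡ ⟨
  ι (n C j) * ι (j !) * ι ((n ∸ j) !) * invFact j * invFact (n ∸ j)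
    ≡⟨ ring (ι (n C j)) (ι (j !)) (ι ((n ∸ j) !)) (invFact j) (invFact (n ∸ j)) ⟩
  ι (n C j) * (ι (j !) * invFact j) * (ι ((n ∸ j) !) * invFact (n ∸ j))
    ≡⟨ cong₂ (λ a b → ι (n C j) * a * b) (ι[n!]*invFact[n]≡1 j) (ι[n!]*invFact[n]≡1 (n ∸ j)) ⟩
  ι (n C j) * 1ℚ * 1ℚ
    ≡⟨ ring′ (ι (n C j)) ⟩
  ι (n C j)
    ∎)
  where
  open ≡-Reasoning
  ring : ∀ c f g a b → c * f * g * a * b ≡ c * (f * a) * (g * b)
  ring = solve-∀ ℚ-ring
  ring′ : ∀ c → c * 1ℚ * 1ℚ ≡ c
  ring′ = solve-∀ ℚ-ring
  ℕ-identity : (n C j) ℕ.* (j ! ℕ.* (n ∸ j) !) ≡ n !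
  ℕ-identity = trans (cong (ℕ._* (j ! ℕ.* (n ∸ j) !)) (nCk≡n!/k![n-k]! j≤n)) (m/n*n≡m {{j !* (n ∸ j) !≢0}} (k![n∸k]!∣n! j≤n))
  ι[n!]≡ : ι (n C j) * ι (j !) * ι ((n ∸ j) !) ≡ ι (n !)
  ι[n!]≡ = trans (ℚ.*-assoc (ι (n C j)) (ι (j !)) (ι ((n ∸ j) !))) (trans (cong (ι (n C j) *_) (sym (ι-* (j !) ((n ∸ j) !))))
    (trans (sym (ι-* (n C j) _)) (cong ι ℕ-identity)))

[n+1]Cn≡n+1 : ∀ n → suc n C n ≡ suc n
[n+1]Cn≡n+1 n = trans (nCk≡nC[n∸k] (ℕ.n≤1+n n)) (trans (cong (suc n C_) (ℕ.m+n∸n≡m 1 n)) (nC1≡n (suc n)))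

sumTo-C-B : ∀ M → sumTo (suc M) (λ j → ι (suc M C j) * B j) ≡ δ₀ M
sumTo-C-B zero    = refl
sumTo-C-B (suc m) = begin
  sumTo (suc m) (λ j → ι (n C j) * B j) + ι (n C suc m) * B (suc m)
    ≡⟨ cong₂ _+_ (sumTo-cong (suc m) (λ j j<n → term j j<n)) (cong₂ _*_ (cong ι ([n+1]Cn≡n+1 (suc m))) (B-suc m)) ⟩
  sumTo (suc m) (λ j → ι (n !) * (B j * invFact j * invFact (n ∸ j))) + ι n * - (ι (suc m !) * S)
    ≡⟨ cong₂ _+_ (sym (*-distribˡ-sumTo (suc m) (ι (n !)) _)) (ring (ι n) (ι (suc m !)) S) ⟩
  ι (n !) * S - ι n * ι (suc m !) * S
    ≡⟨ cong (λ w → ι (n !) * S - w * S) (ι-* n (suc m !)) ⟨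
  ι (n !) * S - ι (n !) * S
    ≡⟨ ℚ.+-inverseʳ (ι (n !) * S) ⟩
  0ℚ
    ∎
  where
  open ≡-Reasoning
  n = suc (suc m)
  S = sumTo (suc m) (λ i → B i * invFact i * invFact (n ∸ i))
  ring : ∀ a b s → a * - (b * s) ≡ - (a * b * s)
  ring = solve-∀ ℚ-ring
  term : ∀ j → j < suc m → ι (n C j) * B j ≡ ι (n !) * (B j * invFact j * invFact (n ∸ j))
  term j j<suc-m = trans (cong (_* B j) (ι-C n j (ℕ.m<n⇒m≤1+n j<suc-m))) (ring′ (ι (n !)) (invFact j) (invFact (n ∸ j)) (B j))
    where
    ring′ : ∀ f a b β → f * a * b * β ≡ f * (β * a * b)
    ring′ = solve-∀ ℚ-ring

-- Central factorials

eval : Poly → ℚ → ℚ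
eval []       x = 0ℚ
eval (a ∷ as) x = a + x * eval as x

eval-addPoly : ∀ a b x → eval (addPoly a b) x ≡ eval a x + eval b x
eval-addPoly []       b        x = sym (ℚ.+-identityˡ (eval b x))
eval-addPoly (a ∷ as) []       x = sym (ℚ.+-identityʳ (eval (a ∷ as) x))
eval-addPoly (a ∷ as) (b ∷ bs) x = trans (cong (λ w → (a + b) + x * w) (eval-addPoly as bs x)) (ring a b x (eval as x) (eval bs x))
  where
  ring : ∀ a b x u v → (a + b) + x * (u + v) ≡ (a + x * u) + (b + x * v)
  ring = solve-∀ ℚ-ring

eval-scalePoly : ∀ c q x → eval (scalePoly c q) x ≡ c * eval q x
eval-scalePoly c []       x = sym (ℚ.*-zeroʳ c)
eval-scalePoly c (a ∷ as) x = trans (cong (λ w → c * a + x * w) (eval-scalePoly c as x)) (ring c a x (eval as x))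
  where
  ring : ∀ c a x u → c * a + x * (c * u) ≡ c * (a + x * u)
  ring = solve-∀ ℚ-ring

eval-mulLinear : ∀ c q x → eval (mulLinear c q) x ≡ (x + c) * eval q x
eval-mulLinear c q x = trans (eval-addPoly (0ℚ ∷ q) (scalePoly c q) x)
  (trans (cong (λ w → (0ℚ + x * eval q x) + w) (eval-scalePoly c q x)) (ring x c (eval q x)))
  where
  ring : ∀ x c u → (0ℚ + x * u) + c * u ≡ (x + c) * u
  ring = solve-∀ ℚ-ring

eval-prodLinear : ∀ m c x → eval (prodLinear m c) x ≡ x * prodFrom1 m (λ j → x + c j)
eval-prodLinear zero    c x = ring x
  where
  ring : ∀ x → 0ℚ + x * (1ℚ + x * 0ℚ) ≡ x * 1ℚ
  ring = solve-∀ ℚ-ring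
eval-prodLinear (suc m) c x = trans (eval-mulLinear (c (suc m)) (prodLinear m c) x)
  (trans (cong ((x + c (suc m)) *_) (eval-prodLinear m c x)) (ring x (c (suc m)) (prodFrom1 m (λ j → x + c j))))
  where
  ring : ∀ x c P → (x + c) * (x * P) ≡ x * (P * (x + c))
  ring = solve-∀ ℚ-ring

eval-sumTo : ∀ q x → eval q x ≡ sumTo (length q) (λ k → coeff q k * x ^ k)
eval-sumTo []       x = refl
eval-sumTo (a ∷ as) x = begin
  a + x * eval as x                                            ≡⟨ cong (λ w → a + x * w) (eval-sumTo as x) ⟩
  a + x * sumTo (length as) (λ k → coeff as k * x ^ k)         ≡⟨ cong (λ w → a + w) (*-distribˡ-sumTo (length as) x _) ⟩
  a + sumTo (length as) (λ k → x * (coeff as k * x ^ k))       ≡⟨ cong₂ _+_ (sym (ℚ.*-identityʳ a)) (sumTo-cong (length as) (λ k _ → ring x (coeff as k) (x ^ k))) ⟩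
  a * 1ℚ + sumTo (length as) (λ k → coeff as k * x ^ suc k)    ≡⟨ sumTo-shift (length as) (λ k → coeff (a ∷ as) k * x ^ k) ⟨
  sumTo (suc (length as)) (λ k → coeff (a ∷ as) k * x ^ k)     ∎
  where
  open ≡-Reasoning
  ring : ∀ x c y → x * (c * y) ≡ c * (x * y)
  ring = solve-∀ ℚ-ring

length-addPoly : ∀ a b → length (addPoly a b) ≡ length a ℕ.⊔ length b
length-addPoly []       b        = refl
length-addPoly (a ∷ as) []       = sym (ℕ.⊔-identityʳ (suc (length as)))
length-addPoly (a ∷ as) (b ∷ bs) = cong suc (length-addPoly as bs)

length-scalePoly : ∀ c q → length (scalePoly c q) ≡ length q
length-scalePoly c []       = refl
length-scalePoly c (a ∷ as) = cong suc (length-scalePoly c as)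

length-mulLinear : ∀ c q → length (mulLinear c q) ≡ suc (length q)
length-mulLinear c q = trans (length-addPoly (0ℚ ∷ q) (scalePoly c q))
  (trans (cong (suc (length q) ℕ.⊔_) (length-scalePoly c q)) (ℕ.m≥n⇒m⊔n≡m (ℕ.n≤1+n (length q))))

length-prodLinear : ∀ m c → length (prodLinear m c) ≡ suc (suc m)
length-prodLinear zero    c = refl
length-prodLinear (suc m) c = trans (length-mulLinear (c (suc m)) (prodLinear m c)) (cong suc (length-prodLinear m c))

length-centralPoly : ∀ n → length (centralPoly n) ≡ suc n
length-centralPoly zero    = refl
length-centralPoly (suc m) = length-prodLinear m _

prodFrom1-cong : ∀ m {f g : ℕ → ℚ} → (∀ j → f j ≡ g j) → prodFrom1 m f ≡ prodFrom1 m g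
prodFrom1-cong zero    f≗g = refl
prodFrom1-cong (suc m) f≗g = cong₂ _*_ (prodFrom1-cong m f≗g) (f≗g (suc m))

prodFrom1-suc : ∀ m (f : ℕ → ℚ) → prodFrom1 (suc m) f ≡ f 1 * prodFrom1 m (λ j → f (suc j))
prodFrom1-suc zero    f = trans (ℚ.*-identityˡ (f 1)) (sym (ℚ.*-identityʳ (f 1)))
prodFrom1-suc (suc m) f = trans (cong (_* f (suc (suc m))) (prodFrom1-suc m f)) (ℚ.*-assoc (f 1) _ _)

centralFactorial-eval : ∀ n x → centralFactorial n x ≡ eval (centralPoly n) x
centralFactorial-eval zero    x = sym (trans (cong (λ w → 1ℚ + w) (ℚ.*-zeroʳ x)) (ℚ.+-identityʳ 1ℚ))
centralFactorial-eval (suc m) x = sym (trans (eval-prodLinear m _ x)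
  (cong (x *_) (prodFrom1-cong m (λ j → sym (ℚ.+-assoc x (half (suc m)) (- ι j))))))

centralFactorial-sumTo : ∀ n x → centralFactorial n x ≡ sumTo (suc n) (λ k → t n k * x ^ k)
centralFactorial-sumTo n x = trans (centralFactorial-eval n x)
  (trans (eval-sumTo (centralPoly n) x) (cong (λ L → sumTo L (λ k → t n k * x ^ k)) (length-centralPoly n)))

half-+2 : ∀ m → half (suc (suc m)) ≡ half m + 1ℚ
half-+2 m = trans (ℚ.fromℚᵘ-cong {ℚᵘ.mkℚᵘ (+ suc (suc m)) 1} {ℚᵘ.mkℚᵘ (+ m) 1 ℚᵘ.+ ℚᵘ.mkℚᵘ (+ 1) 0}
    (ℚᵘ.*≡* (trans (cong (ℤ._* + 2) (ℤ.pos-+ 2 m)) (ring (+ m)))))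
  (fromℚᵘ-homo-+ (ℚᵘ.mkℚᵘ (+ m) 1) (ℚᵘ.mkℚᵘ (+ 1) 0))
  where
  ring : ∀ m → (+ 2 ℤ.+ m) ℤ.* + 2 ≡ (m ℤ.* + 1 ℤ.+ + 1 ℤ.* + 2) ℤ.* + 2
  ring = ℤ-Solver.solve-∀

ι≡half+half : ∀ m → ι m ≡ half m + half m
ι≡half+half m = trans (ℚ.fromℚᵘ-cong {ℚᵘ.mkℚᵘ (+ m) 0} {ℚᵘ.mkℚᵘ (+ m) 1 ℚᵘ.+ ℚᵘ.mkℚᵘ (+ m) 1} (ℚᵘ.*≡* (ring (+ m))))
  (fromℚᵘ-homo-+ (ℚᵘ.mkℚᵘ (+ m) 1) (ℚᵘ.mkℚᵘ (+ m) 1))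
  where
  ring : ∀ m → m ℤ.* + 4 ≡ (m ℤ.* + 2 ℤ.+ m ℤ.* + 2) ℤ.* + 1
  ring = ℤ-Solver.solve-∀

centralFactorial-+2 : ∀ m x → centralFactorial (suc (suc m)) x ≡ (x + half m) * (x - half m) * centralFactorial m x
centralFactorial-+2 zero     x = ring x
  where
  ring : ∀ x → x * (1ℚ * (x + half 2 - ι 1)) ≡ (x + half 0) * (x - half 0) * 1ℚ
  ring = solve-∀ ℚ-ring
centralFactorial-+2 (suc m′) x = begin
  x * prodFrom1 (suc m) F                          ≡⟨ cong (x *_) (prodFrom1-suc m F) ⟩
  x * (F 1 * (prodFrom1 m′ (λ j → F (suc j)) * F (suc m)))
    ≡⟨ cong (λ w → x * (F 1 * (w * F (suc m)))) (prodFrom1-cong m′ F[1+j]≡G[j]) ⟩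
  x * (F 1 * (P * F (suc m)))                      ≡⟨ cong₂ (λ a b → x * (a * (P * b))) F[1]≡x+h F[1+m]≡x-h ⟩
  x * ((x + h) * (P * (x - h)))                    ≡⟨ ring x h P ⟩
  (x + h) * (x - h) * (x * P)                      ∎
  where
  open ≡-Reasoning
  m = suc m′
  h = half m
  F : ℕ → ℚ
  F j = x + half (suc (suc m)) - ι j
  G : ℕ → ℚ
  G j = x + h - ι j
  P = prodFrom1 m′ G
  ring : ∀ x h P → x * ((x + h) * (P * (x - h))) ≡ (x + h) * (x - h) * (x * P)
  ring = solve-∀ ℚ-ring
  ring₁ : ∀ x h → x + (h + 1ℚ) - 1ℚ ≡ x + h
  ring₁ = solve-∀ ℚ-ring
  ring₂ : ∀ x h i → x + (h + 1ℚ) - (i + 1ℚ) ≡ x + h - i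
  ring₂ = solve-∀ ℚ-ring
  ring₃ : ∀ x h → x + (h + 1ℚ) - ((h + h) + 1ℚ) ≡ x - h
  ring₃ = solve-∀ ℚ-ring
  F[1]≡x+h : F 1 ≡ x + h
  F[1]≡x+h = trans (cong (λ w → x + w - 1ℚ) (half-+2 m)) (ring₁ x h)
  F[1+j]≡G[j] : ∀ j → F (suc j) ≡ G j
  F[1+j]≡G[j] j = trans (cong₂ (λ a b → x + a - b) (half-+2 m) (ι-suc j)) (ring₂ x h (ι j))
  F[1+m]≡x-h : F (suc m) ≡ x - h
  F[1+m]≡x-h = trans (cong₂ (λ a b → x + a - b) (half-+2 m) (trans (ι-suc m) (cong (_+ 1ℚ) (ι≡half+half m)))) (ring₃ x h)

x²*centralFactorial : ∀ m x → (x * x) * centralFactorial m x ≡ centralFactorial (suc (suc m)) x + (half m * half m) * centralFactorial m x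
x²*centralFactorial m x = trans (ring x (half m) (centralFactorial m x)) (cong (_+ (half m * half m) * centralFactorial m x) (sym (centralFactorial-+2 m x)))
  where
  ring : ∀ x h c → (x * x) * c ≡ (x + h) * (x - h) * c + (h * h) * c
  ring = solve-∀ ℚ-ring

invPow-inverse : ∀ p .{{_ : ℕ.NonZero p}} N → invPow p N * ι (p ℕ.^ N) ≡ 1ℚ
invPow-inverse (suc k) N = /-*-cancelʳ (+ 1) (suc k ℕ.^ N) {{ℕ.m^n≢0 (suc k) N}}

volkenbornSum-cong : ∀ p {f g : ℚ → ℚ} → (∀ x → f (ι x) ≡ g (ι x)) → ∀ N → volkenbornSum p f N ≡ volkenbornSum p g N
volkenbornSum-cong p f≗g N = cong (invPow p N *_) (sumTo-cong (p ℕ.^ N) (λ x _ → f≗g x))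

volkenbornSum-+ : ∀ p (f g : ℚ → ℚ) N → volkenbornSum p (λ x → f x + g x) N ≡ volkenbornSum p f N + volkenbornSum p g N
volkenbornSum-+ p f g N = trans (cong (invPow p N *_) (sumTo-+ (p ℕ.^ N) _ _)) (ℚ.*-distribˡ-+ (invPow p N) _ _)

volkenbornSum-*ˡ : ∀ p c (f : ℚ → ℚ) N → volkenbornSum p (λ x → c * f x) N ≡ c * volkenbornSum p f N
volkenbornSum-*ˡ p c f N = begin
  invPow p N * sumTo (p ℕ.^ N) (λ x → c * f (ι x)) ≡⟨ cong (invPow p N *_) (*-distribˡ-sumTo (p ℕ.^ N) c _) ⟨
  invPow p N * (c * sumTo (p ℕ.^ N) (λ x → f (ι x))) ≡⟨ ring (invPow p N) c _ ⟩
  c * (invPow p N * sumTo (p ℕ.^ N) (λ x → f (ι x))) ∎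
  where
  open ≡-Reasoning
  ring : ∀ a b c → a * (b * c) ≡ b * (a * c)
  ring = solve-∀ ℚ-ring

volkenbornSum-sumTo : ∀ p K (g : ℕ → ℚ → ℚ) N →
                      volkenbornSum p (λ x → sumTo K (λ k → g k x)) N ≡ sumTo K (λ k → volkenbornSum p (g k) N)
volkenbornSum-sumTo p K g N = trans (cong (invPow p N *_) (sumTo-comm (p ℕ.^ N) K (λ x k → g k (ι x))))
  (*-distribˡ-sumTo K (invPow p N) _)

sumTo-C-volkenbornSum-^ : ∀ p .{{_ : ℕ.NonZero p}} M N →
                          sumTo (suc M) (λ j → ι (suc M C j) * volkenbornSum p (_^ j) N) ≡ ι (p ℕ.^ N) ^ M
sumTo-C-volkenbornSum-^ p M N = begin
  sumTo (suc M) (λ j → ι (suc M C j) * (iP * S j))  ≡⟨ sumTo-cong (suc M) (λ j _ → ring (ι (suc M C j)) iP (S j)) ⟩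
  sumTo (suc M) (λ j → iP * (ι (suc M C j) * S j))  ≡⟨ *-distribˡ-sumTo (suc M) iP _ ⟨
  iP * sumTo (suc M) (λ j → ι (suc M C j) * S j)    ≡⟨ cong (iP *_) (sumTo-C-powerSum M (p ℕ.^ N)) ⟩
  iP * (ι (p ℕ.^ N) * ι (p ℕ.^ N) ^ M)              ≡⟨ ℚ.*-assoc iP _ _ ⟨
  iP * ι (p ℕ.^ N) * ι (p ℕ.^ N) ^ M                ≡⟨ cong (_* ι (p ℕ.^ N) ^ M) (invPow-inverse p N) ⟩
  1ℚ * ι (p ℕ.^ N) ^ M                              ≡⟨ ℚ.*-identityˡ _ ⟩
  ι (p ℕ.^ N) ^ M                                   ∎
  where
  open ≡-Reasoning
  iP = invPow p N
  S : ℕ → ℚ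
  S j = sumTo (p ℕ.^ N) (λ x → ι x ^ j)
  ring : ∀ a b c → a * (b * c) ≡ b * (a * c)
  ring = solve-∀ ℚ-ring

sumTo-C-volkenbornError : ∀ p .{{_ : ℕ.NonZero p}} M N →
                          sumTo (suc M) (λ j → ι (suc M C j) * (volkenbornSum p (_^ j) N - B j)) ≡ ι (p ℕ.^ N) ^ M - δ₀ M
sumTo-C-volkenbornError p M N = begin
  sumTo (suc M) (λ j → c j * (V j - B j))
    ≡⟨ sumTo-cong (suc M) (λ j _ → ring (c j) (V j) (B j)) ⟩
  sumTo (suc M) (λ j → c j * V j - c j * B j)
    ≡⟨ sumTo-- (suc M) _ _ ⟩
  sumTo (suc M) (λ j → c j * V j) - sumTo (suc M) (λ j → c j * B j)
    ≡⟨ cong₂ _-_ (sumTo-C-volkenbornSum-^ p M N) (sumTo-C-B M) ⟩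
  ι (p ℕ.^ N) ^ M - δ₀ M
    ∎
  where
  open ≡-Reasoning
  c : ℕ → ℚ
  c j = ι (suc M C j)
  V : ℕ → ℚ
  V j = volkenbornSum p (_^ j) N
  ring : ∀ c v b → c * (v - b) ≡ c * v - c * b
  ring = solve-∀ ℚ-ring

-- p-adic valuations

record ValuationAtLeast (p m : ℕ) (q : ℚ) : Set where
  constructor valuationAtLeast
  field
    numerator     : ℤ
    denominator   : ℕ
    p∤denominator : ¬ p ∣ denominator
    equation      : q * ι denominator ≡ ι (p ℕ.^ m) * (numerator / 1)

PadicNull : ℕ → (ℕ → ℚ) → Set
PadicNull p a = ∀ m → ∃ λ N₀ → ∀ N → N₀ ≤ N → ValuationAtLeast p m (a N)

-- A record rather than a definition, so that f and L can be inferred from its type.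
record HasVolkenbornIntegral (p : ℕ) (f : ℚ → ℚ) (L : ℚ) : Set where
  constructor hasVolkenbornIntegral
  field
    null : PadicNull p (λ N → volkenbornSum p f N - L)

module _ {p : ℕ} (p-prime : Prime p) where

  private instance
    p-nonTrivial : ℕ.NonTrivial p
    p-nonTrivial = prime⇒nonTrivial p-prime
    p-nonZero : ℕ.NonZero p
    p-nonZero = ℕ.nonTrivial⇒nonZero p

  p∤1 : ¬ p ∣ 1
  p∤1 p∣1 = ℕ.nonTrivial⇒≢1 (∣1⇒≡1 p∣1)

  p∤*p∤⇒p∤* : ∀ {a b} → ¬ p ∣ a → ¬ p ∣ b → ¬ p ∣ a ℕ.* b
  p∤*p∤⇒p∤* {a} {b} p∤a p∤b p∣ab with euclidsLemma a b p-prime p∣ab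
  ... | inj₁ p∣a = p∤a p∣a
  ... | inj₂ p∣b = p∤b p∣b

  p^m∣x*b⇒p^m∣x : ∀ {b} → ¬ p ∣ b → ∀ m x → p ℕ.^ m ∣ x ℕ.* b → p ℕ.^ m ∣ x
  p^m∣x*b⇒p^m∣x p∤b zero    x _ = 1∣ x
  p^m∣x*b⇒p^m∣x {b} p∤b (suc m) x p^m+1∣xb with euclidsLemma x b p-prime (∣-trans (m∣m*n (p ℕ.^ m)) p^m+1∣xb)
  ... | inj₂ p∣b = ⊥-elim (p∤b p∣b)
  ... | inj₁ (divides y refl) = subst (p ℕ.^ suc m ∣_) (ℕ.*-comm p y) (*-monoʳ-∣ p p^m∣y)
    where
    p^m∣y : p ℕ.^ m ∣ y
    p^m∣y = p^m∣x*b⇒p^m∣x p∤b m y (*-cancelˡ-∣ p (subst (p ℕ.* p ℕ.^ m ∣_) (ring y) p^m+1∣xb))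
      where
      ring : ∀ y → y ℕ.* p ℕ.* b ≡ p ℕ.* (y ℕ.* b)
      ring y = trans (cong (ℕ._* b) (ℕ.*-comm y p)) (ℕ.*-assoc p y b)

  PFreeDecomposition : ℕ → Set
  PFreeDecomposition d = ∃₂ λ s b → ¬ p ∣ b × d ≡ p ℕ.^ s ℕ.* b

  p-free-decomposition : ∀ d → .{{ℕ.NonZero d}} → PFreeDecomposition d
  p-free-decomposition = <-rec (λ d → .{{ℕ.NonZero d}} → PFreeDecomposition d) split
    where
    split : ∀ d → (∀ {d′} → d′ < d → .{{ℕ.NonZero d′}} → PFreeDecomposition d′) → .{{ℕ.NonZero d}} → PFreeDecomposition d
    split d rec with p ∣? d
    ... | no p∤d = 0 , d , p∤d , sym (ℕ.+-identityʳ d)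
    ... | yes p∣d@(divides e refl) with rec (quotient-< p∣d) {{quotient≢0 p∣d}}
    ...   | s , b , p∤b , e≡ = suc s , b , p∤b , trans (cong (ℕ._* p) e≡) (ring (p ℕ.^ s) b)
      where
      ring : ∀ x b → x ℕ.* b ℕ.* p ≡ p ℕ.* x ℕ.* b
      ring x b = trans (ℕ.*-comm (x ℕ.* b) p) (sym (ℕ.*-assoc p x b))

  valuation-0 : ∀ m → ValuationAtLeast p m 0ℚ
  valuation-0 m = valuationAtLeast (+ 0) 1 p∤1 (trans (ℚ.*-zeroˡ (ι 1)) (sym (ℚ.*-zeroʳ (ι (p ℕ.^ m)))))

  valuation-+ : ∀ {m x y} → ValuationAtLeast p m x → ValuationAtLeast p m y → ValuationAtLeast p m (x + y)
  valuation-+ {m} {x} {y} (valuationAtLeast a b p∤b x*b≡) (valuationAtLeast a′ b′ p∤b′ y*b′≡) =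
    valuationAtLeast (a ℤ.* + b′ ℤ.+ a′ ℤ.* + b) (b ℕ.* b′) (p∤*p∤⇒p∤* p∤b p∤b′) (begin
      (x + y) * ι (b ℕ.* b′)                   ≡⟨ cong ((x + y) *_) (ι-* b b′) ⟩
      (x + y) * (ι b * ι b′)                   ≡⟨ ring x y (ι b) (ι b′) ⟩
      (x * ι b) * ι b′ + (y * ι b′) * ι b      ≡⟨ cong₂ (λ s t → s * ι b′ + t * ι b) x*b≡ y*b′≡ ⟩
      (P * (a / 1)) * ι b′ + (P * (a′ / 1)) * ι b ≡⟨ ring′ P (a / 1) (a′ / 1) (ι b) (ι b′) ⟩
      P * ((a / 1) * ι b′ + (a′ / 1) * ι b)    ≡⟨ cong (P *_) numerator≡ ⟨
      P * ((a ℤ.* + b′ ℤ.+ a′ ℤ.* + b) / 1)    ∎)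
    where
    open ≡-Reasoning
    P = ι (p ℕ.^ m)
    ring : ∀ x y u v → (x + y) * (u * v) ≡ (x * u) * v + (y * v) * u
    ring = solve-∀ ℚ-ring
    ring′ : ∀ P a a′ u v → (P * a) * v + (P * a′) * u ≡ P * (a * v + a′ * u)
    ring′ = solve-∀ ℚ-ring
    numerator≡ : (a ℤ.* + b′ ℤ.+ a′ ℤ.* + b) / 1 ≡ (a / 1) * ι b′ + (a′ / 1) * ι b
    numerator≡ = trans (/1-homo-+ (a ℤ.* + b′) (a′ ℤ.* + b)) (cong₂ _+_ (/1-homo-* a (+ b′)) (/1-homo-* a′ (+ b)))

  valuation-weaken : ∀ {m′ m x} → m′ ≤ m → ValuationAtLeast p m x → ValuationAtLeast p m′ x
  valuation-weaken {m′} {m} {x} m′≤m (valuationAtLeast a b p∤b x*b≡) =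
    valuationAtLeast (+ (p ℕ.^ (m ∸ m′)) ℤ.* a) b p∤b (begin
      x * ι b                                       ≡⟨ x*b≡ ⟩
      ι (p ℕ.^ m) * (a / 1)                         ≡⟨ cong (λ k → ι (p ℕ.^ k) * (a / 1)) (ℕ.m+[n∸m]≡n m′≤m) ⟨
      ι (p ℕ.^ (m′ ℕ.+ (m ∸ m′))) * (a / 1)         ≡⟨ cong (λ k → ι k * (a / 1)) (ℕ.^-distribˡ-+-* p m′ (m ∸ m′)) ⟩
      ι (p ℕ.^ m′ ℕ.* p ℕ.^ (m ∸ m′)) * (a / 1)     ≡⟨ cong (_* (a / 1)) (ι-* (p ℕ.^ m′) _) ⟩
      ι (p ℕ.^ m′) * ι (p ℕ.^ (m ∸ m′)) * (a / 1)   ≡⟨ ℚ.*-assoc (ι (p ℕ.^ m′)) _ _ ⟩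
      ι (p ℕ.^ m′) * (ι (p ℕ.^ (m ∸ m′)) * (a / 1)) ≡⟨ cong (ι (p ℕ.^ m′) *_) (/1-homo-* (+ (p ℕ.^ (m ∸ m′))) a) ⟨
      ι (p ℕ.^ m′) * ((+ (p ℕ.^ (m ∸ m′)) ℤ.* a) / 1) ∎)
    where open ≡-Reasoning

  valuation-*ˡ-decomposed : ∀ {c s b₀ m x} → ¬ p ∣ b₀ → ↧ₙ c ≡ p ℕ.^ s ℕ.* b₀ →
                            ValuationAtLeast p (s ℕ.+ m) x → ValuationAtLeast p m (c * x)
  valuation-*ˡ-decomposed {c} {s} {b₀} {m} {x} p∤b₀ ↧c≡ (valuationAtLeast a b p∤b x*b≡) =
    valuationAtLeast (↥ c ℤ.* a) (b₀ ℕ.* b) (p∤*p∤⇒p∤* p∤b₀ p∤b) (begin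
      c * x * ι (b₀ ℕ.* b)                                 ≡⟨ cong (c * x *_) (ι-* b₀ b) ⟩
      c * x * (ι b₀ * ι b)                                 ≡⟨ ring c x (ι b₀) (ι b) ⟩
      c * ι b₀ * (x * ι b)                                 ≡⟨ cong (c * ι b₀ *_) x*b≡ ⟩
      c * ι b₀ * (ι (p ℕ.^ (s ℕ.+ m)) * (a / 1))           ≡⟨ cong (λ w → c * ι b₀ * (w * (a / 1))) (trans (cong ι (ℕ.^-distribˡ-+-* p s m)) (ι-* (p ℕ.^ s) (p ℕ.^ m))) ⟩
      c * ι b₀ * (ι (p ℕ.^ s) * ι (p ℕ.^ m) * (a / 1))     ≡⟨ ring′ c (ι b₀) (ι (p ℕ.^ s)) (ι (p ℕ.^ m)) (a / 1) ⟩
      ι (p ℕ.^ m) * ((c * (ι (p ℕ.^ s) * ι b₀)) * (a / 1)) ≡⟨ cong (λ w → ι (p ℕ.^ m) * ((c * w) * (a / 1))) (trans (sym (ι-* (p ℕ.^ s) b₀)) (cong ι (sym ↧c≡))) ⟩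
      ι (p ℕ.^ m) * ((c * ι (↧ₙ c)) * (a / 1))             ≡⟨ cong (λ w → ι (p ℕ.^ m) * (w * (a / 1))) (q*ι[↧q]≡↥q c) ⟩
      ι (p ℕ.^ m) * ((↥ c / 1) * (a / 1))                  ≡⟨ cong (ι (p ℕ.^ m) *_) (/1-homo-* (↥ c) a) ⟨
      ι (p ℕ.^ m) * ((↥ c ℤ.* a) / 1)                      ∎)
    where
    open ≡-Reasoning
    ring : ∀ c x u v → c * x * (u * v) ≡ c * u * (x * v)
    ring = solve-∀ ℚ-ring
    ring′ : ∀ c u S M a → c * u * (S * M * a) ≡ M * ((c * (S * u)) * a)
    ring′ = solve-∀ ℚ-ring

  valuation-*ˡ : ∀ c → ∃ λ s → ∀ {m x} → ValuationAtLeast p (s ℕ.+ m) x → ValuationAtLeast p m (c * x)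
  valuation-*ˡ c with p-free-decomposition (↧ₙ c)
  ... | s , b₀ , p∤b₀ , ↧c≡ = s , valuation-*ˡ-decomposed {c} p∤b₀ ↧c≡

  valuation⇒padicValGE : ∀ {m q} → ValuationAtLeast p m q → padicValGE p m q
  valuation⇒padicValGE {m} {q} (valuationAtLeast a b p∤b q*b≡) =
    p^m∣x*b⇒p^m∣x p∤b m ℤ.∣ ↥ q ∣ (subst (p ℕ.^ m ∣_) (sym ℕ-equation) (∣-trans (m∣m*n ℤ.∣ a ∣) (m∣m*n d))) , p∤d
    where
    open ≡-Reasoning
    d = ↧ₙ q
    ring : ∀ q d b → q * d * b ≡ q * b * d
    ring = solve-∀ ℚ-ring
    ℤ-equation : ↥ q ℤ.* + b ≡ + (p ℕ.^ m) ℤ.* a ℤ.* + d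
    ℤ-equation = /1-injective (↥ q ℤ.* + b) (+ (p ℕ.^ m) ℤ.* a ℤ.* + d) (begin
      (↥ q ℤ.* + b) / 1                ≡⟨ /1-homo-* (↥ q) (+ b) ⟩
      (↥ q / 1) * ι b                  ≡⟨ cong (_* ι b) (q*ι[↧q]≡↥q q) ⟨
      q * ι d * ι b                    ≡⟨ ring q (ι d) (ι b) ⟩
      q * ι b * ι d                    ≡⟨ cong (_* ι d) q*b≡ ⟩
      ι (p ℕ.^ m) * (a / 1) * ι d      ≡⟨ cong (_* ι d) (/1-homo-* (+ (p ℕ.^ m)) a) ⟨
      ((+ (p ℕ.^ m) ℤ.* a) / 1) * ι d  ≡⟨ /1-homo-* (+ (p ℕ.^ m) ℤ.* a) (+ d) ⟨
      (+ (p ℕ.^ m) ℤ.* a ℤ.* + d) / 1  ∎)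
    ℕ-equation : ℤ.∣ ↥ q ∣ ℕ.* b ≡ p ℕ.^ m ℕ.* ℤ.∣ a ∣ ℕ.* d
    ℕ-equation = trans (sym (ℤ.abs-* (↥ q) (+ b)))
      (trans (cong ℤ.∣_∣ ℤ-equation) (trans (ℤ.abs-* (+ (p ℕ.^ m) ℤ.* a) (+ d)) (cong (ℕ._* d) (ℤ.abs-* (+ (p ℕ.^ m)) a))))
    p∤d : ¬ p ∣ d
    p∤d p∣d = [ (λ p∣↥q → ℕ.nonTrivial⇒≢1 (↥↧-coprime q (p∣↥q , p∣d))) , p∤b ]′
      (euclidsLemma ℤ.∣ ↥ q ∣ b p-prime (subst (p ∣_) (sym ℕ-equation) (∣-trans p∣d (n∣m*n (p ℕ.^ m ℕ.* ℤ.∣ a ∣)))))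

  PadicNull-cong : ∀ {a b} → (∀ N → a N ≡ b N) → PadicNull p a → PadicNull p b
  PadicNull-cong a≗b null m =
    let N₀ , small = null m in N₀ , λ N N₀≤N → subst (ValuationAtLeast p m) (a≗b N) (small N N₀≤N)

  PadicNull-0 : PadicNull p (λ _ → 0ℚ)
  PadicNull-0 m = 0 , λ _ _ → valuation-0 m

  PadicNull-+ : ∀ {a b} → PadicNull p a → PadicNull p b → PadicNull p (λ N → a N + b N)
  PadicNull-+ null-a null-b m =
    let N₁ , small-a = null-a m
        N₂ , small-b = null-b m
    in N₁ ℕ.⊔ N₂ , λ N N₁⊔N₂≤N →
      valuation-+ (small-a N (ℕ.m⊔n≤o⇒m≤o N₁ N₂ N₁⊔N₂≤N)) (small-b N (ℕ.m⊔n≤o⇒n≤o N₁ N₂ N₁⊔N₂≤N))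

  PadicNull-*ˡ : ∀ c {a} → PadicNull p a → PadicNull p (λ N → c * a N)
  PadicNull-*ˡ c null m =
    let s , scale = valuation-*ˡ c
        N₀ , small = null (s ℕ.+ m)
    in N₀ , λ N N₀≤N → scale (small N N₀≤N)

  PadicNull-- : ∀ {a b} → PadicNull p a → PadicNull p b → PadicNull p (λ N → a N - b N)
  PadicNull-- {a} {b} null-a null-b = PadicNull-cong (λ N → ring (a N) (b N)) (PadicNull-+ null-a (PadicNull-*ˡ (- 1ℚ) null-b))
    where
    ring : ∀ x y → x + - 1ℚ * y ≡ x - y
    ring = solve-∀ ℚ-ring

  PadicNull-sumTo : ∀ K (a : ℕ → ℕ → ℚ) → (∀ j → j < K → PadicNull p (a j)) → PadicNull p (λ N → sumTo K (λ j → a j N))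
  PadicNull-sumTo zero    a null = PadicNull-0
  PadicNull-sumTo (suc K) a null = PadicNull-+ (PadicNull-sumTo K a (λ j j<K → null j (ℕ.m<n⇒m<1+n j<K))) (null K ℕ.≤-refl)

  PadicNull-[p^N]^[1+M] : ∀ M → PadicNull p (λ N → ι (p ℕ.^ N) ^ suc M)
  PadicNull-[p^N]^[1+M] M m = m , λ N m≤N → valuation-weaken m≤N (valuationAtLeast (+ ((p ℕ.^ N) ℕ.^ M)) 1 p∤1
    (trans (ℚ.*-identityʳ _) (cong (ι (p ℕ.^ N) *_) (ι-^ (p ℕ.^ N) M))))

  -- Volkenborn integrals

  HasVolkenbornIntegral⇒VolkenbornIntegral : ∀ {f L} → HasVolkenbornIntegral p f L → VolkenbornIntegral p f L
  HasVolkenbornIntegral⇒VolkenbornIntegral (hasVolkenbornIntegral ∫f) m =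
    let N₀ , small = ∫f m in N₀ , λ N N₀≤N → valuation⇒padicValGE (small N N₀≤N)

  HasVolkenbornIntegral-cong : ∀ {f g L} → HasVolkenbornIntegral p f L → (∀ x → f (ι x) ≡ g (ι x)) →
                               HasVolkenbornIntegral p g L
  HasVolkenbornIntegral-cong {f} {g} {L} (hasVolkenbornIntegral ∫f) f≗g =
    hasVolkenbornIntegral (PadicNull-cong (λ N → cong (_- L) (volkenbornSum-cong p {f} {g} f≗g N)) ∫f)

  HasVolkenbornIntegral-+ : ∀ {f g L L′} → HasVolkenbornIntegral p f L → HasVolkenbornIntegral p g L′ →
                            HasVolkenbornIntegral p (λ x → f x + g x) (L + L′)
  HasVolkenbornIntegral-+ {f} {g} {L} {L′} (hasVolkenbornIntegral ∫f) (hasVolkenbornIntegral ∫g) =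
    hasVolkenbornIntegral (PadicNull-cong split (PadicNull-+ ∫f ∫g))
    where
    ring : ∀ a b l l′ → (a - l) + (b - l′) ≡ (a + b) - (l + l′)
    ring = solve-∀ ℚ-ring
    split : ∀ N → (volkenbornSum p f N - L) + (volkenbornSum p g N - L′) ≡ volkenbornSum p (λ x → f x + g x) N - (L + L′)
    split N = trans (ring (volkenbornSum p f N) (volkenbornSum p g N) L L′) (cong (_- (L + L′)) (sym (volkenbornSum-+ p f g N)))

  HasVolkenbornIntegral-*ˡ : ∀ c {f L} → HasVolkenbornIntegral p f L → HasVolkenbornIntegral p (λ x → c * f x) (c * L)
  HasVolkenbornIntegral-*ˡ c {f} {L} (hasVolkenbornIntegral ∫f) = hasVolkenbornIntegral (PadicNull-cong scale (PadicNull-*ˡ c ∫f))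
    where
    ring : ∀ c a l → c * (a - l) ≡ c * a - c * l
    ring = solve-∀ ℚ-ring
    scale : ∀ N → c * (volkenbornSum p f N - L) ≡ volkenbornSum p (λ x → c * f x) N - c * L
    scale N = trans (ring c (volkenbornSum p f N) L) (cong (_- c * L) (sym (volkenbornSum-*ˡ p c f N)))

  HasVolkenbornIntegral-sumTo : ∀ K {g : ℕ → ℚ → ℚ} {L : ℕ → ℚ} → (∀ k → k < K → HasVolkenbornIntegral p (g k) (L k)) →
                                HasVolkenbornIntegral p (λ x → sumTo K (λ k → g k x)) (sumTo K L)
  HasVolkenbornIntegral-sumTo K {g} {L} ∫g = hasVolkenbornIntegral
    (PadicNull-cong split (PadicNull-sumTo K (λ k N → volkenbornSum p (g k) N - L k) (λ k k<K → HasVolkenbornIntegral.null (∫g k k<K))))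
    where
    split : ∀ N → sumTo K (λ k → volkenbornSum p (g k) N - L k) ≡ volkenbornSum p (λ x → sumTo K (λ k → g k x)) N - sumTo K L
    split N = trans (sumTo-- K _ L) (cong (_- sumTo K L) (sym (volkenbornSum-sumTo p K g N)))

  HasVolkenbornIntegral-^ : ∀ j → HasVolkenbornIntegral p (_^ j) (B j)
  HasVolkenbornIntegral-^ j = hasVolkenbornIntegral (<-rec (λ j → PadicNull p (E j)) step j)
    where
    E : ℕ → ℕ → ℚ
    E j N = volkenbornSum p (_^ j) N - B j
    PadicNull-[p^N]^M-δ₀ : ∀ M → PadicNull p (λ N → ι (p ℕ.^ N) ^ M - δ₀ M)
    PadicNull-[p^N]^M-δ₀ zero    = PadicNull-cong (λ _ → sym (ℚ.+-inverseʳ 1ℚ)) PadicNull-0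
    PadicNull-[p^N]^M-δ₀ (suc M) = PadicNull-cong (λ _ → sym (ℚ.+-identityʳ _)) (PadicNull-[p^N]^[1+M] M)
    step : ∀ M → (∀ {j} → j < M → PadicNull p (E j)) → PadicNull p (E M)
    step M ih = PadicNull-cong solve-for-E (PadicNull-*ˡ r (PadicNull-- (PadicNull-[p^N]^M-δ₀ M)
      (PadicNull-sumTo M (λ j N → ι (suc M C j) * E j N) (λ j j<M → PadicNull-*ˡ (ι (suc M C j)) (ih j<M)))))
      where
      r = + 1 / suc M
      ring : ∀ r s c e → r * ((s + c * e) - s) ≡ (r * c) * e
      ring = solve-∀ ℚ-ring
      solve-for-E : ∀ N → r * ((ι (p ℕ.^ N) ^ M - δ₀ M) - sumTo M (λ j → ι (suc M C j) * E j N)) ≡ E M N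
      solve-for-E N = begin
        r * ((ι (p ℕ.^ N) ^ M - δ₀ M) - S)   ≡⟨ cong (λ w → r * (w - S)) (sumTo-C-volkenbornError p M N) ⟨
        r * ((S + ι (suc M C M) * E M N) - S) ≡⟨ cong (λ c → r * ((S + ι c * E M N) - S)) ([n+1]Cn≡n+1 M) ⟩
        r * ((S + ι (suc M) * E M N) - S)     ≡⟨ ring r S (ι (suc M)) (E M N) ⟩
        (r * ι (suc M)) * E M N               ≡⟨ cong (_* E M N) (/-*-cancelʳ (+ 1) (suc M)) ⟩
        1ℚ * E M N                            ≡⟨ ℚ.*-identityˡ (E M N) ⟩
        E M N                                 ∎
        where
        open ≡-Reasoning
        S = sumTo M (λ j → ι (suc M C j) * E j N)

  HasVolkenbornIntegral-polynomial : ∀ K (c : ℕ → ℚ) →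
                                     HasVolkenbornIntegral p (λ x → sumTo K (λ k → c k * x ^ k)) (sumTo K (λ k → c k * B k))
  HasVolkenbornIntegral-polynomial K c = HasVolkenbornIntegral-sumTo K (λ k _ → HasVolkenbornIntegral-*ˡ (c k) (HasVolkenbornIntegral-^ k))

  HasVolkenbornIntegral-centralFactorial : ∀ n → HasVolkenbornIntegral p (centralFactorial n) (sumTo (suc n) (λ k → t n k * B k))
  HasVolkenbornIntegral-centralFactorial n =
    HasVolkenbornIntegral-cong (HasVolkenbornIntegral-polynomial (suc n) (t n)) (λ x → sym (centralFactorial-sumTo n (ι x)))

mainTheorem3 : (p : ℕ) → Prime p → p ≢ 2 → (n : ℕ) → 2 ≤ n →
    VolkenbornIntegral p (λ x → (x * x) * centralFactorial (n ∸ 2) x)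
      (sumTo (suc n) (λ k → t n k * B k)
        + ((+ (n ∸ 2) / 2) * (+ (n ∸ 2) / 2)) * sumTo (suc (n ∸ 2)) (λ k → t (n ∸ 2) k * B k))
mainTheorem3 p p-prime _ (suc (suc m)) (s≤s (s≤s _)) = HasVolkenbornIntegral⇒VolkenbornIntegral p-prime ∫x²x^[m]
  where
  ∫x²x^[m] : HasVolkenbornIntegral p (λ x → (x * x) * centralFactorial m x)
               (sumTo (suc (suc (suc m))) (λ k → t (suc (suc m)) k * B k) + (half m * half m) * sumTo (suc m) (λ k → t m k * B k))
  ∫x²x^[m] = HasVolkenbornIntegral-cong p-prime
    (HasVolkenbornIntegral-+ p-prime (HasVolkenbornIntegral-centralFactorial p-prime (suc (suc m)))
      (HasVolkenbornIntegral-*ˡ p-prime (half m * half m) (HasVolkenbornIntegral-centralFactorial p-prime m)))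
    (λ x → sym (x²*centralFactorial m (ι x)))
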